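{- Almost all graphs have conflict-free connection number $2$; that is, the proportion of graphs on $n$ labeled vertices $G$ with $cfc(G)=2$ among all graphs on these $n$ labeled vertices tends to $1$ as $n\to\infty$.
   Context: For a connected graph $G$ with an edge-coloring (adjacent edges may share colors), a path is conflict-free if some color appears on exactly one of its edges; the coloring is a conflict-free connection coloring if every two distinct vertices are joined by a conflict-free path. The conflict-free connection number $cfc(G)$ is the minimum number of colors in such a coloring. -}

module Defs where

open import Data.Nat using (ℕ; zero; suc; _<_; _≤_; _*_; _∸_; _^_)
open import Data.Nat.Combinatorics using (_C_)
open import Data.Bool using (Bool; true; false)
open import Data.Fin using (Fin; _≟_)
open import Data.List using (List; []; _∷_; length; filter)
open import Data.List.Relation.Unary.Unique.Propositional using (Unique)
open import Data.List.Relation.Unary.All using (All)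
open import Data.List.Relation.Unary.AllPairs using (AllPairs)
open import Data.Product using (Σ; ∃; ∃-syntax; _×_; _,_)
open import Relation.Binary.PropositionalEquality using (_≡_; _≢_)
open import Relation.Nullary using (¬_)

record Graph (n : ℕ) : Set where
  field
    adj   : Fin n → Fin n → Bool
    sym   : ∀ i j → adj i j ≡ adj j i
    irrefl : ∀ i → adj i i ≡ false
open Graph public

Differ : ∀ {n} → Graph n → Graph n → Set
Differ G H = ∃[ i ] ∃[ j ] adj G i j ≢ adj H i j

data Walk {n : ℕ} (G : Graph n) : Fin n → Fin n → Set where
  stop : ∀ {u} → Walk G u u
  step : ∀ {v w} (u : Fin n) → adj G u v ≡ true → Walk G v w → Walk G u w

vertices : ∀ {n} {G : Graph n} {u v} → Walk G u v → List (Fin n)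
vertices {v = v} stop = v ∷ []
vertices (step u _ p) = u ∷ vertices p

IsPath : ∀ {n} {G : Graph n} {u v} → Walk G u v → Set
IsPath p = Unique (vertices p)

Connected : ∀ {n} → Graph n → Set
Connected {n} G = ∀ (u v : Fin n) → u ≢ v → Σ (Walk G u v) IsPath

-- An edge-coloring of G with k colors (adjacent edges may share colors).
-- Values on non-edges are irrelevant.
record EdgeColoring {n : ℕ} (G : Graph n) (k : ℕ) : Set where
  field
    col    : Fin n → Fin n → Fin k
    colSym : ∀ i j → col i j ≡ col j i
open EdgeColoring public

colorsOn : ∀ {n} {G : Graph n} {k} → EdgeColoring G k → ∀ {u v} → Walk G u v → List (Fin k)
colorsOn c stop = []
colorsOn c (step {v = v} u _ p) = col c u v ∷ colorsOn c p

ConflictFree : ∀ {n} {G : Graph n} {k} → EdgeColoring G k → ∀ {u v} → Walk G u v → Set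
ConflictFree {k = k} c p = ∃[ a ] length (filter (_≟ a) (colorsOn c p)) ≡ 1

IsCFCColoring : ∀ {n} {G : Graph n} {k} → EdgeColoring G k → Set
IsCFCColoring {n} {G} c = ∀ (u v : Fin n) → u ≢ v →
  ∃[ p ] (IsPath {G = G} {u} {v} p × ConflictFree c p)

HasCFC : ∀ {n} → Graph n → ℕ → Set
HasCFC G k = Σ (EdgeColoring G k) IsCFCColoring

CfcEq : ∀ {n} → Graph n → ℕ → Set
CfcEq G m = Connected G × HasCFC G m × (∀ k → k < m → ¬ HasCFC G k)

numGraphs : ℕ → ℕ
numGraphs n = 2 ^ (n C 2)

module Submission where

-- Fix a vertex a.  If G is not complete, has at least
-- three vertices, and every two distinct vertices u, v ≠ a have a common
-- neighbour that is adjacent to a as well (the extension property of a),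
-- then cfc(G) = 2: colour an edge "inner" when its ends lie in the same one
-- of the classes {a}, N(a), V ∖ N[a], and "cross" otherwise; every
-- non-adjacent pair is joined by a path of length 2 or 3 carrying exactly one
-- inner edge.  A non-edge rules out a conflict-free colouring with one colour.
--
-- Graphs on n = n₀ + 3 vertices are encoded by vectors of
-- C(n,2) bits.  For fixed u, v the stars {xa, xu, xv} of the n₀ remaining
-- vertices x are pairwise disjoint sets of coordinates; a general lemma on
-- Boolean vectors shows that at most a (7/8)^n₀ fraction of vectors covers no
-- such star.  A union bound over the n² pairs plus the complete graph bounds
-- the graphs that are not good by n²(7/8)^n₀·2^C(n,2) + 1, and an elementary
-- estimate of n²(7/8)^n₀ shows this is at most a 1/K fraction for large n.

open import Defs hiding (sym)
open import Data.Nat hiding (_≟_)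
open import Data.Nat.Properties hiding (_≟_)
open import Data.Nat.Combinatorics using (_C_; nC1≡n; nCk+nC[k+1]≡[n+1]C[k+1])
open import Data.Nat.Tactic.RingSolver using (solve-∀)
open import Data.Bool using (Bool; true; false; not; _∧_; _∨_; if_then_else_; T?)
import Data.Bool.Properties as Boolₚ
open import Data.Bool.ListAction using (all; any)
open import Data.Empty using (⊥-elim-irr)
open import Data.Fin using (Fin; zero; suc; _≟_; _↑ˡ_; _↑ʳ_; splitAt)
open import Data.Fin.Properties using (↑ˡ-injective; ↑ʳ-injective; splitAt-↑ˡ; splitAt-↑ʳ; splitAt⁻¹-↑ˡ; splitAt⁻¹-↑ʳ)
  renaming (suc-injective to fsuc-injective)
open import Data.Vec using (Vec; []; _∷_; lookup)
import Data.Vec.Properties as Vecₚ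
open import Data.List using (List; []; _∷_; length; map; _++_; filter; filterᵇ; allFin; tabulate)
import Data.List.Properties as Listₚ
open import Data.List.Membership.Propositional using (_∈_)
open import Data.List.Membership.Propositional.Properties using (∈-map⁻; ∈-allFin)
open import Data.List.Relation.Unary.Any using (here; there)
open import Data.List.Relation.Unary.All as All using (All; []; _∷_)
import Data.List.Relation.Unary.All.Properties as Allₚ
open import Data.List.Relation.Unary.AllPairs as AllPairs using (AllPairs; []; _∷_)
import Data.List.Relation.Unary.AllPairs.Properties as AllPairsₚ
open import Data.List.Relation.Unary.Unique.Propositional using (Unique)
import Data.List.Relation.Unary.Unique.Propositional.Properties as Uniqueₚ
open import Data.Product using (Σ; ∃; ∃-syntax; _×_; _,_; proj₁; proj₂)
open import Data.Sum using (_⊎_; inj₁; inj₂)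
open import Function using (_∘_; id)
open import Function.Bundles using (Equivalence)
open import Relation.Nullary using (¬_; yes; no; does; contradiction)
open import Relation.Nullary.Decidable using (dec-true; dec-false)
open import Relation.Binary.PropositionalEquality

_==_ : ∀ {n} → Fin n → Fin n → Bool
i == j = does (i ≟ j)

==-refl : ∀ {n} (i : Fin n) → i == i ≡ true
==-refl i = dec-true (i ≟ i) refl

==-true⇒≡ : ∀ {n} {i j : Fin n} → i == j ≡ true → i ≡ j
==-true⇒≡ {i = i} {j} eq with i ≟ j
... | yes i≡j = i≡j

==-false : ∀ {n} {i j : Fin n} → i ≢ j → i == j ≡ false
==-false {i = i} {j} = dec-false (i ≟ j)

==-false⇒≢ : ∀ {n} {i j : Fin n} → i == j ≡ false → i ≢ j
==-false⇒≢ {i = i} eq refl with () ← trans (sym (==-refl i)) eq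

∨≡false : ∀ {b c} → b ∨ c ≡ false → b ≡ false × c ≡ false
∨≡false {false} eq = refl , eq

not-∧ : ∀ b c → not (b ∧ c) ≡ not b ∨ not c
not-∧ true c = refl
not-∧ false c = refl

∧≡true : ∀ {b c} → b ∧ c ≡ true → b ≡ true × c ≡ true
∧≡true {true} eq = refl , eq

module _ {ℓ} {A : Set ℓ} where

  count : (A → Bool) → List A → ℕ
  count p [] = 0
  count p (x ∷ xs) = if p x then suc (count p xs) else count p xs

  length-filterᵇ : ∀ (p : A → Bool) xs → length (filterᵇ p xs) ≡ count p xs
  length-filterᵇ p [] = refl
  length-filterᵇ p (x ∷ xs) with p x
  ... | true = cong suc (length-filterᵇ p xs)
  ... | false = length-filterᵇ p xs

  count-++ : ∀ (p : A → Bool) xs ys → count p (xs ++ ys) ≡ count p xs + count p ys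
  count-++ p [] ys = refl
  count-++ p (x ∷ xs) ys with p x
  ... | true = cong suc (count-++ p xs ys)
  ... | false = count-++ p xs ys

  count-cong : ∀ {p q : A → Bool} xs → (∀ x → p x ≡ q x) → count p xs ≡ count q xs
  count-cong [] eq = refl
  count-cong {p} {q} (x ∷ xs) eq rewrite eq x with q x
  ... | true = cong suc (count-cong xs eq)
  ... | false = count-cong xs eq

  count-mono : ∀ {p q : A → Bool} xs → (∀ x → p x ≡ true → q x ≡ true) → count p xs ≤ count q xs
  count-mono [] p⇒q = z≤n
  count-mono {p} {q} (x ∷ xs) p⇒q with p x in px | q x in qx
  ... | true | true = s≤s (count-mono xs p⇒q)
  ... | true | false with () ← trans (sym (p⇒q x px)) qx
  ... | false | true = m≤n⇒m≤1+n (count-mono xs p⇒q)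
  ... | false | false = count-mono xs p⇒q

  count-none : ∀ {p : A → Bool} {xs} → All (λ x → p x ≡ false) xs → count p xs ≡ 0
  count-none [] = refl
  count-none {p} {x ∷ _} (px ∷ pxs) rewrite px = count-none pxs

  count-∨ : ∀ (p q : A → Bool) xs → count (λ x → p x ∨ q x) xs ≤ count p xs + count q xs
  count-∨ p q [] = z≤n
  count-∨ p q (x ∷ xs) with p x | q x
  ... | true | true = s≤s (≤-trans (count-∨ p q xs) (+-monoʳ-≤ (count p xs) (n≤1+n _)))
  ... | true | false = s≤s (count-∨ p q xs)
  ... | false | true = ≤-trans (s≤s (count-∨ p q xs)) (≤-reflexive (sym (+-suc _ _)))
  ... | false | false = count-∨ p q xs

  count-split : ∀ (p q : A → Bool) xs →
    count (λ x → p x ∧ q x) xs + count (λ x → not (p x) ∧ q x) xs ≡ count q xs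
  count-split p q [] = refl
  count-split p q (x ∷ xs) with p x | q x
  ... | true | true = cong suc (count-split p q xs)
  ... | true | false = count-split p q xs
  ... | false | true = trans (+-suc _ _) (cong suc (count-split p q xs))
  ... | false | false = count-split p q xs

  count-complement : ∀ (p : A → Bool) xs → count p xs + count (not ∘ p) xs ≡ length xs
  count-complement p [] = refl
  count-complement p (x ∷ xs) with p x
  ... | true = cong suc (count-complement p xs)
  ... | false = trans (+-suc _ _) (cong suc (count-complement p xs))

  count-≤-length : ∀ (p : A → Bool) xs → count p xs ≤ length xs
  count-≤-length p xs = ≤-trans (m≤m+n _ _) (≤-reflexive (count-complement p xs))

  all-elim : ∀ {p : A → Bool} {xs x} → all p xs ≡ true → x ∈ xs → p x ≡ true
  all-elim {p} {y ∷ _} holds (here refl) = proj₁ (∧≡true {p y} holds)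
  all-elim {p} {y ∷ _} holds (there x∈xs) = all-elim (proj₂ (∧≡true {p y} holds)) x∈xs

  all-intro : ∀ {p : A → Bool} {xs} → All (λ x → p x ≡ true) xs → all p xs ≡ true
  all-intro [] = refl
  all-intro (px ∷ pxs) rewrite px = all-intro pxs

  any-intro : ∀ {p : A → Bool} {xs x} → x ∈ xs → p x ≡ true → any p xs ≡ true
  any-intro (here refl) px rewrite px = refl
  any-intro {p} {y ∷ _} (there x∈xs) px = trans (cong (p y ∨_) (any-intro x∈xs px)) (Boolₚ.∨-zeroʳ (p y))

  any-elim : ∀ {p : A → Bool} xs → any p xs ≡ true → ∃[ x ] (x ∈ xs × p x ≡ true)
  any-elim {p} (x ∷ xs) holds with p x in px
  ... | true = x , here refl , px
  ... | false with any-elim xs holds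
  ... | y , y∈xs , py = y , there y∈xs , py

count-map : ∀ {ℓ ℓ'} {A : Set ℓ} {B : Set ℓ'} (p : B → Bool) (h : A → B) xs →
  count p (map h xs) ≡ count (p ∘ h) xs
count-map p h [] = refl
count-map p h (x ∷ xs) with p (h x)
... | true = cong suc (count-map p h xs)
... | false = count-map p h xs

count-notAll : ∀ {I A : Set} (is : List I) (P : I → A → Bool) (xs : List A) D E →
  (∀ i → count (λ x → not (P i x)) xs * D ≤ E) →
  count (λ x → not (all (λ i → P i x) is)) xs * D ≤ length is * E
count-notAll [] P xs D E each = ≤-reflexive (cong (_* D) (count-none (All.universal (λ _ → refl) xs)))
count-notAll {A = A} (i ∷ is) P xs D E each = begin
    count (λ x → not (P i x ∧ rest x)) xs * D
      ≤⟨ *-monoˡ-≤ D (≤-trans (≤-reflexive (count-cong xs (λ x → not-∧ (P i x) (rest x))))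
                             (count-∨ _ _ xs)) ⟩
    (count (λ x → not (P i x)) xs + count (λ x → not (rest x)) xs) * D
      ≡⟨ *-distribʳ-+ D (count (λ x → not (P i x)) xs) _ ⟩
    count (λ x → not (P i x)) xs * D + count (λ x → not (rest x)) xs * D
      ≤⟨ +-mono-≤ (each i) (count-notAll is P xs D E each) ⟩
    E + length is * E ∎
  where
    open ≤-Reasoning
    rest : A → Bool
    rest x = all (λ i → P i x) is

AllPairs-refine : ∀ {A : Set} {P : A → Set} {R S : A → A → Set} {xs} →
  (∀ {x y} → P x → P y → R x y → S x y) → All P xs → AllPairs R xs → AllPairs S xs
AllPairs-refine strengthen [] [] = []
AllPairs-refine strengthen (px ∷ pxs) (rs ∷ rss) =
  All.zipWith (λ (py , r) → strengthen px py r) (pxs , rs) ∷ AllPairs-refine strengthen pxs rss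

count-==-≤1 : ∀ {n} (c : Fin n) xs → Unique xs → count (_== c) xs ≤ 1
count-==-≤1 c [] [] = z≤n
count-==-≤1 c (x ∷ xs) (x∉xs ∷ unique) with x ≟ c
... | yes refl = s≤s (≤-reflexive (count-none (All.map (λ x≢y → ==-false (x≢y ∘ sym)) x∉xs)))
... | no _ = count-==-≤1 c xs unique

count-anyOf : ∀ {ℓ} {A B : Set ℓ} (P : B → A → Bool) βs xs → (∀ β → count (P β) xs ≤ 1) →
  count (λ x → any (λ β → P β x) βs) xs ≤ length βs
count-anyOf P [] xs _ = ≤-reflexive (count-none (All.universal (λ _ → refl) xs))
count-anyOf P (β ∷ βs) xs once =
  ≤-trans (count-∨ (P β) (λ x → any (λ β → P β x) βs) xs) (+-mono-≤ (once β) (count-anyOf P βs xs once))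

allVecs : ∀ m → List (Vec Bool m)
allVecs zero = [] ∷ []
allVecs (suc m) = map (true ∷_) (allVecs m) ++ map (false ∷_) (allVecs m)

length-allVecs : ∀ m → length (allVecs m) ≡ 2 ^ m
length-allVecs zero = refl
length-allVecs (suc m) = begin
    length (map (true ∷_) V ++ map (false ∷_) V)
      ≡⟨ Listₚ.length-++ (map (true ∷_) V) ⟩
    length (map (true ∷_) V) + length (map (false ∷_) V)
      ≡⟨ cong₂ _+_ (Listₚ.length-map _ V) (Listₚ.length-map _ V) ⟩
    length V + length V
      ≡⟨ cong (λ k → k + k) (length-allVecs m) ⟩
    2 ^ m + 2 ^ m
      ≡⟨ cong (2 ^ m +_) (sym (+-identityʳ _)) ⟩
    2 ^ suc m ∎
  where
    open ≡-Reasoning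
    V : List (Vec Bool m)
    V = allVecs m

allVecs-unique : ∀ m → Unique (allVecs m)
allVecs-unique zero = [] ∷ []
allVecs-unique (suc m) =
  Uniqueₚ.++⁺ (Uniqueₚ.map⁺ Vecₚ.∷-injectiveʳ V!) (Uniqueₚ.map⁺ Vecₚ.∷-injectiveʳ V!) headsDiffer
  where
    V! : Unique (allVecs m)
    V! = allVecs-unique m
    headsDiffer : ∀ {f} → ¬ (f ∈ map (true ∷_) (allVecs m) × f ∈ map (false ∷_) (allVecs m))
    headsDiffer (p , q) with ∈-map⁻ (true ∷_) p | ∈-map⁻ (false ∷_) q
    ... | _ , _ , refl | _ , _ , ()

card : ∀ {m} → (Vec Bool m → Bool) → ℕ
card {m} Q = count Q (allVecs m)

card-cons : ∀ {m} (Q : Vec Bool (suc m) → Bool) → card Q ≡ card (Q ∘ (true ∷_)) + card (Q ∘ (false ∷_))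
card-cons {m} Q = trans (count-++ Q (map (true ∷_) (allVecs m)) _)
  (cong₂ _+_ (count-map Q (true ∷_) (allVecs m)) (count-map Q (false ∷_) (allVecs m)))

card-cong : ∀ {m} {P Q : Vec Bool m → Bool} → (∀ f → P f ≡ Q f) → card P ≡ card Q
card-cong {m} = count-cong (allVecs m)

card-≤ : ∀ {m} (Q : Vec Bool m → Bool) → card Q ≤ 2 ^ m
card-≤ {m} Q = ≤-trans (count-≤-length Q (allVecs m)) (≤-reflexive (length-allVecs m))

count-tabulate : ∀ {ℓ} {A : Set ℓ} {n} (p : A → Bool) (h : Fin n → A) →
  count p (tabulate h) ≡ count (p ∘ h) (allFin n)
count-tabulate {n = zero} p h = refl
count-tabulate {n = suc n} p h with p (h zero)
... | true = cong suc (trans (count-tabulate p (h ∘ suc)) (sym (count-tabulate (p ∘ h) suc)))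
... | false = trans (count-tabulate p (h ∘ suc)) (sym (count-tabulate (p ∘ h) suc))

Mask : ℕ → Set
Mask m = Fin m → Bool

weight : ∀ {m} → Mask m → ℕ
weight {m} M = count M (allFin m)

covers : ∀ {m} → Mask m → Vec Bool m → Bool
covers M [] = true
covers M (b ∷ f) = (if M zero then b else true) ∧ covers (M ∘ suc) f

IndependentOf : ∀ {m} → Mask m → (Vec Bool m → Bool) → Set
IndependentOf M Q = ∀ f g → (∀ i → M i ≡ false → lookup f i ≡ lookup g i) → Q f ≡ Q g

Disjoint : ∀ {m} → Mask m → Mask m → Set
Disjoint M M' = ∀ i → M i ≡ true → M' i ≡ false

Disjoint-sym : ∀ {m} {M M' : Mask m} → Disjoint M M' → Disjoint M' M
Disjoint-sym {M = M} disjoint i on' with M i in on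
... | false = refl
... | true with () ← trans (sym on') (disjoint i on)

CoverCount : ∀ {m} → Mask m → Set
CoverCount {m} M = ∀ (Q : Vec Bool m → Bool) → IndependentOf M Q →
  card (λ f → covers M f ∧ Q f) * 2 ^ weight M ≡ card Q

-- CoverCount is proved by induction on the length, splitting on the first
-- coordinate: if it lies outside M, both halves of the cube are counted by
-- the induction hypothesis; if it lies in M, only the half with first bit 1
-- covers M, and Q takes the same values on both halves.
module _ {m : ℕ} (M : Mask (suc m)) where

  private
    M' : Mask m
    M' = M ∘ suc

  covers-skip : M zero ≡ false → ∀ b f → covers M (b ∷ f) ≡ covers M' f
  covers-skip off b f rewrite off = refl

  covers-hit : M zero ≡ true → ∀ b f → covers M (b ∷ f) ≡ b ∧ covers M' f
  covers-hit on b f rewrite on = refl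

  weight-skip : M zero ≡ false → weight M ≡ weight M'
  weight-skip off rewrite off = count-tabulate M suc

  weight-hit : M zero ≡ true → weight M ≡ suc (weight M')
  weight-hit on rewrite on = cong suc (count-tabulate M suc)

  independent-tail : ∀ {Q} b → IndependentOf M Q → IndependentOf M' (Q ∘ (b ∷_))
  independent-tail b indep f g agree = indep (b ∷ f) (b ∷ g) λ { zero _ → refl ; (suc i) off → agree i off }

  coverCount-skip : M zero ≡ false → CoverCount M' → CoverCount M
  coverCount-skip off IH Q indep = begin
      card (λ f → covers M f ∧ Q f) * 2 ^ weight M
        ≡⟨ cong₂ (λ c w → c * 2 ^ w) (trans (card-cons (λ f → covers M f ∧ Q f))
             (cong₂ _+_ (card-cong (skip true)) (card-cong (skip false)))) (weight-skip off) ⟩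
      (X₁ + X₀) * 2 ^ weight M'
        ≡⟨ *-distribʳ-+ (2 ^ weight M') X₁ X₀ ⟩
      X₁ * 2 ^ weight M' + X₀ * 2 ^ weight M'
        ≡⟨ cong₂ _+_ (IH Q₁ (independent-tail true indep)) (IH Q₀ (independent-tail false indep)) ⟩
      card Q₁ + card Q₀
        ≡⟨ card-cons Q ⟨
      card Q ∎
    where
      open ≡-Reasoning
      Q₁ Q₀ : Vec Bool m → Bool
      Q₁ = Q ∘ (true ∷_)
      Q₀ = Q ∘ (false ∷_)
      X₁ X₀ : ℕ
      X₁ = card (λ f → covers M' f ∧ Q₁ f)
      X₀ = card (λ f → covers M' f ∧ Q₀ f)
      skip : ∀ b f → covers M (b ∷ f) ∧ Q (b ∷ f) ≡ covers M' f ∧ Q (b ∷ f)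
      skip b f = cong (_∧ Q (b ∷ f)) (covers-skip off b f)

  coverCount-hit : M zero ≡ true → CoverCount M' → CoverCount M
  coverCount-hit on IH Q indep = begin
      card (λ f → covers M f ∧ Q f) * 2 ^ weight M
        ≡⟨ cong₂ (λ c w → c * 2 ^ w) (trans (card-cons (λ f → covers M f ∧ Q f))
             (cong₂ _+_ (card-cong hitTrue) (card-cong hitFalse))) (weight-hit on) ⟩
      (X₁ + card {m} (λ _ → false)) * (2 * 2 ^ weight M')
        ≡⟨ cong (λ c → (X₁ + c) * (2 * 2 ^ weight M')) (count-none (All.universal (λ _ → refl) (allVecs m))) ⟩
      (X₁ + 0) * (2 * 2 ^ weight M')
        ≡⟨ double X₁ (2 ^ weight M') ⟩
      X₁ * 2 ^ weight M' + X₁ * 2 ^ weight M'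
        ≡⟨ cong (λ c → c + c) (IH Q₁ (independent-tail true indep)) ⟩
      card Q₁ + card Q₁
        ≡⟨ cong (card Q₁ +_) (card-cong {m} (λ f → indep (true ∷ f) (false ∷ f) firstBitIgnored)) ⟩
      card Q₁ + card Q₀
        ≡⟨ card-cons Q ⟨
      card Q ∎
    where
      open ≡-Reasoning
      Q₁ Q₀ : Vec Bool m → Bool
      Q₁ = Q ∘ (true ∷_)
      Q₀ = Q ∘ (false ∷_)
      X₁ : ℕ
      X₁ = card (λ f → covers M' f ∧ Q₁ f)
      hitTrue : ∀ f → covers M (true ∷ f) ∧ Q₁ f ≡ covers M' f ∧ Q₁ f
      hitTrue f = cong (_∧ Q₁ f) (covers-hit on true f)
      hitFalse : ∀ f → covers M (false ∷ f) ∧ Q₀ f ≡ false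
      hitFalse f = cong (_∧ Q₀ f) (covers-hit on false f)
      firstBitIgnored : ∀ {f} i → M i ≡ false → lookup (true ∷ f) i ≡ lookup (false ∷ f) i
      firstBitIgnored zero off with () ← trans (sym on) off
      firstBitIgnored (suc i) _ = refl
      double : ∀ x y → (x + 0) * (2 * y) ≡ x * y + x * y
      double = solve-∀

card-covers : ∀ {m} (M : Mask m) → CoverCount M
card-covers {zero} M Q indep = *-identityʳ _
card-covers {suc m} M = byFirstBit (M zero) refl
  where
    byFirstBit : ∀ b → M zero ≡ b → CoverCount M
    byFirstBit false off = coverCount-skip M off (card-covers (M ∘ suc))
    byFirstBit true on = coverCount-hit M on (card-covers (M ∘ suc))

covers-elim : ∀ {m} (M : Mask m) f → covers M f ≡ true → ∀ i → M i ≡ true → lookup f i ≡ true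
covers-elim M (b ∷ f) cov zero on rewrite on = proj₁ (∧≡true cov)
covers-elim M (b ∷ f) cov (suc i) on = covers-elim (M ∘ suc) f (proj₂ (∧≡true {if M zero then b else true} cov)) i on

uncovered : ∀ {m} (M : Mask m) f → covers M f ≡ false → ∃[ i ] (M i ≡ true × lookup f i ≡ false)
uncovered M (b ∷ f) notCov with M zero in on | b
... | true | false = zero , on , refl
... | true | true = let i , Mi , fi = uncovered (M ∘ suc) f notCov in suc i , Mi , fi
... | false | _ = let i , Mi , fi = uncovered (M ∘ suc) f notCov in suc i , Mi , fi

covers-independent : ∀ {m} (M M' : Mask m) → Disjoint M' M → IndependentOf M (covers M')
covers-independent {zero} M M' disjoint [] [] agree = refl
covers-independent {suc m} M M' disjoint (b ∷ f) (c ∷ g) agree =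
  cong₂ _∧_ firstBit (covers-independent (M ∘ suc) (M' ∘ suc) (disjoint ∘ suc) f g (agree ∘ suc))
  where
    firstBit : (if M' zero then b else true) ≡ (if M' zero then c else true)
    firstBit with M' zero in on
    ... | true = agree zero (disjoint zero on)
    ... | false = refl

avoidsAll : ∀ {m} → List (Mask m) → Vec Bool m → Bool
avoidsAll Ms f = all (λ M → not (covers M f)) Ms

avoidsAll-independent : ∀ {m} (M : Mask m) Ms → All (λ M' → Disjoint M' M) Ms → IndependentOf M (avoidsAll Ms)
avoidsAll-independent M [] [] f g agree = refl
avoidsAll-independent M (M' ∷ Ms) (disjoint ∷ disjoints) f g agree =
  cong₂ _∧_ (cong not (covers-independent M M' disjoint f g agree)) (avoidsAll-independent M Ms disjoints f g agree)

fraction-step : ∀ {X Y Z} q → X + Y ≡ Z → Z ≤ Y * q → X * q ≤ (q ∸ 1) * Z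
fraction-step {X} {Y} {Z} q split Z≤Yq = begin
    X * q       ≤⟨ m+n≤o⇒m≤o∸n (X * q) XqZ≤qZ ⟩
    q * Z ∸ Z   ≡⟨ cong (q * Z ∸_) (*-identityˡ Z) ⟨
    q * Z ∸ 1 * Z ≡⟨ *-distribʳ-∸ Z q 1 ⟨
    (q ∸ 1) * Z ∎
  where
    open ≤-Reasoning
    XqZ≤qZ : X * q + Z ≤ q * Z
    XqZ≤qZ = begin
      X * q + Z      ≤⟨ +-monoʳ-≤ (X * q) Z≤Yq ⟩
      X * q + Y * q  ≡⟨ *-distribʳ-+ q X Y ⟨
      (X + Y) * q    ≡⟨ cong (_* q) split ⟩
      Z * q          ≡⟨ *-comm Z q ⟩
      q * Z          ∎

card-avoiding : ∀ {m} w (Ms : List (Mask m)) → AllPairs Disjoint Ms → All (λ M → weight M ≤ w) Ms →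
  card (avoidsAll Ms) * (2 ^ w) ^ length Ms ≤ (2 ^ w ∸ 1) ^ length Ms * 2 ^ m
card-avoiding {m} w [] [] [] = begin
    card {m} (λ _ → true) * 1 ≡⟨ *-identityʳ _ ⟩
    card {m} (λ _ → true)     ≤⟨ card-≤ {m} (λ _ → true) ⟩
    2 ^ m                     ≡⟨ +-identityʳ _ ⟨
    1 * 2 ^ m                 ∎
  where open ≤-Reasoning
card-avoiding {m} w (M ∷ Ms) (M#Ms ∷ disjoint) (wM ∷ weights) = begin
    X * (q * q ^ L)          ≡⟨ *-assoc X q (q ^ L) ⟨
    X * q * q ^ L            ≤⟨ *-monoˡ-≤ (q ^ L) (fraction-step {X} {Y} q split Z≤Yq) ⟩
    (q ∸ 1) * Z * q ^ L      ≡⟨ *-assoc (q ∸ 1) Z (q ^ L) ⟩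
    (q ∸ 1) * (Z * q ^ L)    ≤⟨ *-monoʳ-≤ (q ∸ 1) (card-avoiding w Ms disjoint weights) ⟩
    (q ∸ 1) * ((q ∸ 1) ^ L * 2 ^ m) ≡⟨ *-assoc (q ∸ 1) ((q ∸ 1) ^ L) (2 ^ m) ⟨
    (q ∸ 1) ^ suc L * 2 ^ m  ∎
  where
    open ≤-Reasoning
    q L : ℕ
    q = 2 ^ w
    L = length Ms
    R : Vec Bool m → Bool
    R = avoidsAll Ms
    X Y Z : ℕ
    X = card (λ f → not (covers M f) ∧ R f)
    Y = card (λ f → covers M f ∧ R f)
    Z = card R
    split : X + Y ≡ Z
    split = trans (+-comm X Y) (count-split (covers M) R (allVecs m))
    Z≤Yq : Z ≤ Y * q
    Z≤Yq = begin
      Z                 ≡⟨ card-covers M R (avoidsAll-independent M Ms (All.map Disjoint-sym M#Ms)) ⟨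
      Y * 2 ^ weight M  ≤⟨ *-monoʳ-≤ Y (^-monoʳ-≤ 2 wM) ⟩
      Y * q             ∎

card-coversAll : ∀ m → card (covers {m} (λ _ → true)) ≤ 1
card-coversAll m = *-cancelʳ-≤ _ 1 (2 ^ m) {{m^n≢0 2 m}} (begin
    card (covers full) * 2 ^ m
      ≡⟨ cong₂ (λ c w → c * 2 ^ w) (card-cong {m} (λ f → Boolₚ.∧-identityʳ (covers full f))) weight-full ⟨
    card (λ f → covers full f ∧ true) * 2 ^ weight full
      ≡⟨ card-covers full (λ _ → true) (λ _ _ _ → refl) ⟩
    card {m} (λ _ → true)
      ≤⟨ card-≤ {m} (λ _ → true) ⟩
    2 ^ m
      ≡⟨ *-identityˡ _ ⟨
    1 * 2 ^ m ∎)
  where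
    open ≤-Reasoning
    full : Mask m
    full _ = true
    weight-full : weight full ≡ m
    weight-full = begin-equality
      weight full                                   ≡⟨ +-identityʳ _ ⟨
      weight full + 0                               ≡⟨ cong (weight full +_) noFalse ⟨
      weight full + count (not ∘ full) (allFin m)   ≡⟨ count-complement full (allFin m) ⟩
      length (allFin m)                             ≡⟨ Listₚ.length-tabulate id ⟩
      m                                             ∎
      where
        noFalse : count (not ∘ full) (allFin m) ≡ 0
        noFalse = count-none (All.universal (λ _ → refl) (allFin m))

pairs : ℕ → ℕ
pairs zero = 0
pairs (suc n) = n + pairs n

pairs≡nC2 : ∀ n → pairs n ≡ n C 2
pairs≡nC2 zero = refl
pairs≡nC2 (suc n) = trans (cong₂ _+_ (sym (nC1≡n n)) (pairs≡nC2 n)) (nCk+nC[k+1]≡[n+1]C[k+1] n 1)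

-- Position of the unordered pair {i, j} among the pairs n coordinates: the
-- pairs containing vertex 0 come first, then the pairs inside the other vertices.
pairIndex : ∀ {n} (i j : Fin n) → .(i ≢ j) → Fin (pairs n)
pairIndex {suc n} zero zero i≢j = ⊥-elim-irr (i≢j refl)
pairIndex {suc n} zero (suc j) _ = j ↑ˡ pairs n
pairIndex {suc n} (suc i) zero _ = i ↑ˡ pairs n
pairIndex {suc n} (suc i) (suc j) i≢j = n ↑ʳ pairIndex i j (i≢j ∘ cong suc)

pairIndex-sym : ∀ {n} (i j : Fin n) .(i≢j : i ≢ j) → pairIndex i j i≢j ≡ pairIndex j i (i≢j ∘ sym)
pairIndex-sym zero zero i≢j = ⊥-elim-irr (i≢j refl)
pairIndex-sym zero (suc j) _ = refl
pairIndex-sym (suc i) zero _ = refl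
pairIndex-sym {suc n} (suc i) (suc j) i≢j = cong (n ↑ʳ_) (pairIndex-sym i j (i≢j ∘ cong suc))

↑ˡ≢↑ʳ : ∀ n {m} (x : Fin n) (y : Fin m) → x ↑ˡ m ≢ n ↑ʳ y
↑ˡ≢↑ʳ n {m} x y eq with () ← trans (sym (splitAt-↑ˡ n x m)) (trans (cong (splitAt n) eq) (splitAt-↑ʳ n m y))

pairIndex-injective : ∀ {n} (i j i' j' : Fin n) .(i≢j : i ≢ j) .(i'≢j' : i' ≢ j') →
  pairIndex i j i≢j ≡ pairIndex i' j' i'≢j' → (i ≡ i' × j ≡ j') ⊎ (i ≡ j' × j ≡ i')
pairIndex-injective zero zero _ _ i≢j _ _ = ⊥-elim-irr (i≢j refl)
pairIndex-injective _ _ zero zero _ i'≢j' _ = ⊥-elim-irr (i'≢j' refl)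
pairIndex-injective {suc n} zero (suc j) zero (suc j') _ _ eq = inj₁ (refl , cong suc (↑ˡ-injective (pairs n) j j' eq))
pairIndex-injective {suc n} zero (suc j) (suc i') zero _ _ eq = inj₂ (refl , cong suc (↑ˡ-injective (pairs n) j i' eq))
pairIndex-injective {suc n} zero (suc j) (suc i') (suc j') _ _ eq = contradiction eq (↑ˡ≢↑ʳ n j _)
pairIndex-injective {suc n} (suc i) zero zero (suc j') _ _ eq = inj₂ (cong suc (↑ˡ-injective (pairs n) i j' eq) , refl)
pairIndex-injective {suc n} (suc i) zero (suc i') zero _ _ eq = inj₁ (cong suc (↑ˡ-injective (pairs n) i i' eq) , refl)
pairIndex-injective {suc n} (suc i) zero (suc i') (suc j') _ _ eq = contradiction eq (↑ˡ≢↑ʳ n i _)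
pairIndex-injective {suc n} (suc i) (suc j) zero (suc j') _ _ eq = contradiction (sym eq) (↑ˡ≢↑ʳ n j' _)
pairIndex-injective {suc n} (suc i) (suc j) (suc i') zero _ _ eq = contradiction (sym eq) (↑ˡ≢↑ʳ n i' _)
pairIndex-injective {suc n} (suc i) (suc j) (suc i') (suc j') i≢j i'≢j' eq
  with pairIndex-injective i j i' j' (i≢j ∘ cong suc) (i'≢j' ∘ cong suc) (↑ʳ-injective n _ _ eq)
... | inj₁ (i≡i' , j≡j') = inj₁ (cong suc i≡i' , cong suc j≡j')
... | inj₂ (i≡j' , j≡i') = inj₂ (cong suc i≡j' , cong suc j≡i')

pairIndex-surjective : ∀ {n} (p : Fin (pairs n)) →
  Σ (Fin n) λ i → Σ (Fin n) λ j → Σ (i ≢ j) λ i≢j → pairIndex i j i≢j ≡ p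
pairIndex-surjective {suc n} p with splitAt n p in split
... | inj₁ x = zero , suc x , (λ ()) , splitAt⁻¹-↑ˡ split
... | inj₂ y with pairIndex-surjective {n} y
... | i , j , i≢j , eq = suc i , suc j , i≢j ∘ fsuc-injective , trans (cong (n ↑ʳ_) eq) (splitAt⁻¹-↑ʳ split)

differentCoordinate : ∀ {m} (f g : Vec Bool m) → f ≢ g → ∃[ p ] lookup f p ≢ lookup g p
differentCoordinate [] [] f≢g = contradiction refl f≢g
differentCoordinate (b ∷ f) (c ∷ g) bf≢cg with b Boolₚ.≟ c
... | no b≢c = zero , b≢c
... | yes refl with differentCoordinate f g (bf≢cg ∘ cong (b ∷_))
... | p , differ = suc p , differ

module _ {n : ℕ} where

  adjOf : Vec Bool (pairs n) → Fin n → Fin n → Bool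
  adjOf f i j with i ≟ j
  ... | yes _ = false
  ... | no i≢j = lookup f (pairIndex i j i≢j)

  adjOf-pair : ∀ (f : Vec Bool (pairs n)) {i j} (i≢j : i ≢ j) → adjOf f i j ≡ lookup f (pairIndex i j i≢j)
  adjOf-pair f {i} {j} i≢j with i ≟ j
  ... | yes i≡j = contradiction i≡j i≢j
  ... | no _ = refl

  adjOf-irrefl : ∀ (f : Vec Bool (pairs n)) i → adjOf f i i ≡ false
  adjOf-irrefl f i with i ≟ i
  ... | yes _ = refl
  ... | no i≢i = contradiction refl i≢i

  adjOf-sym : ∀ (f : Vec Bool (pairs n)) i j → adjOf f i j ≡ adjOf f j i
  adjOf-sym f i j with i ≟ j
  ... | yes refl = sym (adjOf-irrefl f i)
  ... | no i≢j = trans (cong (lookup f) (pairIndex-sym i j i≢j)) (sym (adjOf-pair f (i≢j ∘ sym)))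

  decode : Vec Bool (pairs n) → Graph n
  decode f = record { adj = adjOf f ; sym = adjOf-sym f ; irrefl = adjOf-irrefl f }

  decode-differ : ∀ (f g : Vec Bool (pairs n)) → f ≢ g → Differ (decode f) (decode g)
  decode-differ f g f≢g with differentCoordinate f g f≢g
  ... | p , differ with pairIndex-surjective {n} p
  ... | i , j , i≢j , index≡p = i , j , λ same → differ (begin
      lookup f p                      ≡⟨ cong (lookup f) index≡p ⟨
      lookup f (pairIndex i j i≢j)    ≡⟨ adjOf-pair f i≢j ⟨
      adjOf f i j                     ≡⟨ same ⟩
      adjOf g i j                     ≡⟨ adjOf-pair g i≢j ⟩
      lookup g (pairIndex i j i≢j)    ≡⟨ cong (lookup g) index≡p ⟩
      lookup g p                      ∎)
    where open ≡-Reasoning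

  edgeMask : Fin n → Fin n → Mask (pairs n)
  edgeMask i j with i ≟ j
  ... | yes _ = λ _ → false
  ... | no i≢j = _== pairIndex i j i≢j

  edgeMask-weight : ∀ i j → weight (edgeMask i j) ≤ 1
  edgeMask-weight i j with i ≟ j
  ... | yes _ = ≤-trans (≤-reflexive (count-none (All.universal (λ _ → refl) (allFin (pairs n))))) z≤n
  ... | no i≢j = count-==-≤1 (pairIndex i j i≢j) (allFin (pairs n)) (Uniqueₚ.allFin⁺ (pairs n))

  edgeMask-self : ∀ {i j} (i≢j : i ≢ j) → edgeMask i j (pairIndex i j i≢j) ≡ true
  edgeMask-self {i} {j} i≢j with i ≟ j
  ... | yes i≡j = contradiction i≡j i≢j
  ... | no _ = ==-refl (pairIndex i j i≢j)

  edgeMask-elim : ∀ i j p → edgeMask i j p ≡ true → Σ (i ≢ j) λ i≢j → p ≡ pairIndex i j i≢j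
  edgeMask-elim i j p on with i ≟ j
  ... | no i≢j = i≢j , ==-true⇒≡ on

Adjacent : ∀ {n} → Graph n → Fin n → Fin n → Set
Adjacent G u v = adj G u v ≡ true

module _ {n : ℕ} (G : Graph n) where

  adjacent-sym : ∀ {u v} → Adjacent G u v → Adjacent G v u
  adjacent-sym {u} {v} uv = trans (Graph.sym G v u) uv

  adjacent⇒≢ : ∀ {u v} → Adjacent G u v → u ≢ v
  adjacent⇒≢ {u} uv refl = contradiction (trans (sym uv) (irrefl G u)) λ ()

  path₁ : ∀ {u v} → Adjacent G u v → Σ (Walk G u v) IsPath
  path₁ uv = step _ uv stop , (adjacent⇒≢ uv ∷ []) ∷ [] ∷ []

  path₂ : ∀ {u x v} → Adjacent G u x → Adjacent G x v → u ≢ v → Σ (Walk G u v) IsPath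
  path₂ ux xv u≢v = step _ ux (step _ xv stop) ,
    (adjacent⇒≢ ux ∷ u≢v ∷ []) ∷ (adjacent⇒≢ xv ∷ []) ∷ [] ∷ []

  path₃ : ∀ {u x y v} → Adjacent G u x → Adjacent G x y → Adjacent G y v →
    u ≢ y → x ≢ v → u ≢ v → Σ (Walk G u v) IsPath
  path₃ ux xy yv u≢y x≢v u≢v = step _ ux (step _ xy (step _ yv stop)) ,
    (adjacent⇒≢ ux ∷ u≢y ∷ u≢v ∷ []) ∷ (adjacent⇒≢ xy ∷ x≢v ∷ []) ∷
    (adjacent⇒≢ yv ∷ []) ∷ [] ∷ []

  path₁-conflictFree : ∀ {k} (c : EdgeColoring G k) {u v} (uv : Adjacent G u v) → ConflictFree c (proj₁ (path₁ uv))
  path₁-conflictFree c {u} {v} uv = col c u v , cong length (Listₚ.filter-accept (_≟ col c u v) {xs = []} refl)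

  cfc-connected : ∀ {k} (c : EdgeColoring G k) → IsCFCColoring c → Connected G
  cfc-connected c isCFC u v u≢v with isCFC u v u≢v
  ... | p , isPath , _ = p , isPath

  monochrome-singleEdge : ∀ (c : EdgeColoring G 1) {u v} (p : Walk G u v) →
    ConflictFree c p → Adjacent G u v
  monochrome-singleEdge c (step u uv stop) _ = uv
  monochrome-singleEdge c p@(step _ _ (step _ _ _)) (zero , once) =
    contradiction (trans (sym (filter-everything (colorsOn c p))) once) λ ()
    where
      filter-everything : ∀ (cs : List (Fin 1)) → length (filter (_≟ zero) cs) ≡ length cs
      filter-everything [] = refl
      filter-everything (zero ∷ cs) = cong suc (filter-everything cs)

  cfc-atLeast2 : (∃[ i ] ∃[ j ] (i ≢ j × adj G i j ≡ false)) → ∀ k → k < 2 → ¬ HasCFC G k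
  cfc-atLeast2 (i , j , i≢j , nonEdge) zero _ (c , isCFC) with isCFC i j i≢j
  ... | _ , _ , () , _
  cfc-atLeast2 (i , j , i≢j , nonEdge) (suc zero) _ (c , isCFC) with isCFC i j i≢j
  ... | p , _ , cf = contradiction (trans (sym nonEdge) (monochrome-singleEdge c p cf)) λ ()
  cfc-atLeast2 _ (suc (suc k)) (s≤s (s≤s ()))

-- Every non-adjacent pair is then joined
-- by a path of length 2 or 3 on which inner occurs exactly once.
module ExtensionColouring {n : ℕ} (G : Graph n) (a : Fin n)
  (third : ∀ u → ∃[ w ] (w ≢ a × w ≢ u))
  (extend : ∀ u v → u ≢ a → v ≢ a → u ≢ v → ∃[ x ] (Adjacent G x a × Adjacent G x u × Adjacent G x v))
  where

  data Class : Set where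
    root near far : Class

  class : Fin n → Class
  class v with v ≟ a | adj G v a
  ... | yes _ | _ = root
  ... | no _ | true = near
  ... | no _ | false = far

  class-root : class a ≡ root
  class-root with a ≟ a
  ... | yes _ = refl
  ... | no a≢a = contradiction refl a≢a

  class-near : ∀ {v} → Adjacent G v a → class v ≡ near
  class-near {v} va with v ≟ a
  ... | yes v≡a = contradiction v≡a (adjacent⇒≢ G va)
  ... | no _ rewrite va = refl

  class-far : ∀ {v} → v ≢ a → adj G v a ≡ false → class v ≡ far
  class-far {v} v≢a va with v ≟ a
  ... | yes v≡a = contradiction v≡a v≢a
  ... | no _ rewrite va = refl

  classes-differ : ∀ {u v} → class u ≢ class v → u ≢ v
  classes-differ differ refl = differ refl

  data View (v : Fin n) : Set where
    isRoot : v ≡ a → View v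
    isNear : v ≢ a → Adjacent G v a → View v
    isFar  : v ≢ a → class v ≡ far → View v

  view : ∀ v → View v
  view v with v ≟ a | adj G v a in va
  ... | yes v≡a | _ = isRoot v≡a
  ... | no v≢a | true = isNear v≢a va
  ... | no v≢a | false = isFar v≢a (class-far v≢a va)

  inner cross : Fin 2
  inner = zero
  cross = suc zero

  tone : Class → Class → Fin 2
  tone root root = inner
  tone near near = inner
  tone far far = inner
  tone _ _ = cross

  tone-sym : ∀ s t → tone s t ≡ tone t s
  tone-sym root root = refl
  tone-sym root near = refl
  tone-sym root far = refl
  tone-sym near root = refl
  tone-sym near near = refl
  tone-sym near far = refl
  tone-sym far root = refl
  tone-sym far near = refl
  tone-sym far far = refl

  colouring : EdgeColoring G 2
  colouring = record { col = λ u v → tone (class u) (class v) ; colSym = λ u v → tone-sym (class u) (class v) }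

  GoodPath : Fin n → Fin n → Set
  GoodPath u v = ∃[ p ] (IsPath {G = G} {u} {v} p × ConflictFree colouring p)

  InnerOnce : List (Fin 2) → Set
  InnerOnce cs = length (filter (_≟ inner) cs) ≡ 1

  good₂ : ∀ {u x v s t r} → Adjacent G u x → Adjacent G x v → u ≢ v →
    class u ≡ s → class x ≡ t → class v ≡ r → InnerOnce (tone s t ∷ tone t r ∷ []) → GoodPath u v
  good₂ ux xv u≢v refl refl refl once = proj₁ path , proj₂ path , inner , once
    where
      path : Σ (Walk G _ _) IsPath
      path = path₂ G ux xv u≢v

  good₃ : ∀ {u x y v s t r q} → Adjacent G u x → Adjacent G x y → Adjacent G y v → u ≢ y → x ≢ v → u ≢ v →
    class u ≡ s → class x ≡ t → class y ≡ r → class v ≡ q → InnerOnce (tone s t ∷ tone t r ∷ tone r q ∷ []) →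
    GoodPath u v
  good₃ ux xy yv u≢y x≢v u≢v refl refl refl refl once = proj₁ path , proj₂ path , inner , once
    where
      path : Σ (Walk G _ _) IsPath
      path = path₃ G ux xy yv u≢y x≢v u≢v

  reach : ∀ {u} → u ≢ a → ∃[ x ] (Adjacent G x a × Adjacent G x u)
  reach {u} u≢a with third u
  ... | w , w≢a , w≢u with extend u w u≢a w≢a (w≢u ∘ sym)
  ... | x , xa , xu , _ = x , xa , xu

  near≢far : ∀ {x v} → Adjacent G x a → class v ≡ far → x ≢ v
  near≢far xa vFar = classes-differ λ same → contradiction (trans (sym (class-near xa)) (trans same vFar)) λ ()

  -- a – x – y – v with x, y ∈ N(a): colours cross, inner, cross.
  rootToFar : ∀ {v} → v ≢ a → class v ≡ far → GoodPath a v
  rootToFar v≢a vFar with reach v≢a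
  ... | y , ya , yv with reach (adjacent⇒≢ G ya)
  ... | x , xa , xy = good₃ (adjacent-sym G xa) xy yv (adjacent⇒≢ G ya ∘ sym) (near≢far xa vFar) (v≢a ∘ sym)
    class-root (class-near xa) (class-near ya) vFar refl

  -- u – y – x – a, the reverse of the previous case.
  farToRoot : ∀ {u} → u ≢ a → class u ≡ far → GoodPath u a
  farToRoot u≢a uFar with reach u≢a
  ... | y , ya , yu with reach (adjacent⇒≢ G ya)
  ... | x , xa , xy = good₃ (adjacent-sym G yu) (adjacent-sym G xy) xa (near≢far xa uFar ∘ sym) (adjacent⇒≢ G ya) u≢a
    uFar (class-near ya) (class-near xa) class-root refl

  -- u – a – x – v with x a common neighbour of a, u, v: colours cross, cross, inner.
  nearToNear : ∀ {u v} → u ≢ a → Adjacent G u a → v ≢ a → Adjacent G v a → u ≢ v → GoodPath u v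
  nearToNear u≢a ua v≢a va u≢v with extend _ _ u≢a v≢a u≢v
  ... | x , xa , xu , xv = good₃ ua (adjacent-sym G xa) xv (adjacent⇒≢ G xu ∘ sym) (v≢a ∘ sym) u≢v
    (class-near ua) class-root (class-near xa) (class-near va) refl

  -- u – x – v with x a common neighbour of a, u, v: colours inner, cross.
  nearToFar : ∀ {u v} → u ≢ a → Adjacent G u a → v ≢ a → class v ≡ far → u ≢ v → GoodPath u v
  nearToFar u≢a ua v≢a vFar u≢v with extend _ _ u≢a v≢a u≢v
  ... | x , xa , xu , xv = good₂ (adjacent-sym G xu) xv u≢v (class-near ua) (class-near xa) vFar refl

  -- u – x – v as before: colours cross, inner.
  farToNear : ∀ {u v} → u ≢ a → class u ≡ far → v ≢ a → Adjacent G v a → u ≢ v → GoodPath u v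
  farToNear u≢a uFar v≢a va u≢v with extend _ _ u≢a v≢a u≢v
  ... | x , xa , xu , xv = good₂ (adjacent-sym G xu) xv u≢v uFar (class-near xa) (class-near va) refl

  -- u – x – y – v with x ∈ N(a) adjacent to u and y a common neighbour of a, x, v.
  farToFar : ∀ {u v} → u ≢ a → class u ≡ far → v ≢ a → class v ≡ far → u ≢ v → GoodPath u v
  farToFar u≢a uFar v≢a vFar u≢v with reach u≢a
  ... | x , xa , xu with extend _ _ v≢a (adjacent⇒≢ G xa) (near≢far xa vFar ∘ sym)
  ... | y , ya , yv , yx =
    good₃ (adjacent-sym G xu) (adjacent-sym G yx) yv (near≢far ya uFar ∘ sym) (near≢far xa vFar) u≢v
      uFar (class-near xa) (class-near ya) vFar refl

  nonAdjacent : ∀ {u v} → u ≢ v → adj G u v ≡ false → View u → View v → GoodPath u v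
  nonAdjacent u≢v _ (isRoot refl) (isRoot refl) = contradiction refl u≢v
  nonAdjacent _ uv (isRoot refl) (isNear _ va) = contradiction (trans (sym uv) (adjacent-sym G va)) λ ()
  nonAdjacent _ uv (isNear _ ua) (isRoot refl) = contradiction (trans (sym uv) ua) λ ()
  nonAdjacent _ _ (isRoot refl) (isFar v≢a vFar) = rootToFar v≢a vFar
  nonAdjacent _ _ (isFar u≢a uFar) (isRoot refl) = farToRoot u≢a uFar
  nonAdjacent u≢v _ (isNear u≢a ua) (isNear v≢a va) = nearToNear u≢a ua v≢a va u≢v
  nonAdjacent u≢v _ (isNear u≢a ua) (isFar v≢a vFar) = nearToFar u≢a ua v≢a vFar u≢v
  nonAdjacent u≢v _ (isFar u≢a uFar) (isNear v≢a va) = farToNear u≢a uFar v≢a va u≢v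
  nonAdjacent u≢v _ (isFar u≢a uFar) (isFar v≢a vFar) = farToFar u≢a uFar v≢a vFar u≢v

  isCFC : IsCFCColoring colouring
  isCFC u v u≢v with adj G u v in uv
  ... | true = proj₁ (path₁ G uv) , proj₂ (path₁ G uv) , path₁-conflictFree G colouring uv
  ... | false = nonAdjacent u≢v uv (view u) (view v)

extension⇒cfc≡2 : ∀ {n} (G : Graph n) (a : Fin n) →
  (∀ u → ∃[ w ] (w ≢ a × w ≢ u)) →
  (∀ u v → u ≢ a → v ≢ a → u ≢ v → ∃[ x ] (Adjacent G x a × Adjacent G x u × Adjacent G x v)) →
  (∃[ i ] ∃[ j ] (i ≢ j × adj G i j ≡ false)) → CfcEq G 2
extension⇒cfc≡2 G a third extend nonEdge =
  cfc-connected G colouring isCFC , (colouring , isCFC) , cfc-atLeast2 G nonEdge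
  where open ExtensionColouring G a third extend

-- Arithmetic estimates: n²(7/8)^n tends to 0, made explicit.
cube : ℕ → ℕ
cube x = x * x * x

-- One step of the comparison 7^j (j + 22)^3 versus 8^j: the cubic factor
-- grows by less than 8/7 from j + 22 to j + 23.
cube-step : ∀ j → 7 * cube (j + 23) ≤ 8 * cube (j + 22)
cube-step j = ≤-trans (m≤m+n _ _) (≤-reflexive (sym (expand j)))
  where
    expand : ∀ y → 8 * ((y + 22) * (y + 22) * (y + 22)) ≡
      7 * ((y + 23) * (y + 23) * (y + 23)) + (y * y * y + 45 * (y * y) + 507 * y + 15)
    expand = solve-∀

cube-vs-exponential : ∀ j → cube (j + 22) * 7 ^ j ≤ 10648 * 8 ^ j
cube-vs-exponential zero = ≤-refl
cube-vs-exponential (suc j) = begin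
    cube (suc j + 22) * (7 * 7 ^ j)   ≡⟨ cong (λ t → cube t * (7 * 7 ^ j)) (+-suc j 22) ⟨
    cube (j + 23) * (7 * 7 ^ j)       ≡⟨ swap7 (cube (j + 23)) (7 ^ j) ⟩
    7 * cube (j + 23) * 7 ^ j         ≤⟨ *-monoˡ-≤ (7 ^ j) (cube-step j) ⟩
    8 * cube (j + 22) * 7 ^ j         ≡⟨ *-assoc 8 (cube (j + 22)) (7 ^ j) ⟩
    8 * (cube (j + 22) * 7 ^ j)       ≤⟨ *-monoʳ-≤ 8 (cube-vs-exponential j) ⟩
    8 * (10648 * 8 ^ j)               ≡⟨ swap8 (8 ^ j) ⟩
    10648 * (8 * 8 ^ j)               ∎
  where
    open ≤-Reasoning
    swap7 : ∀ x y → x * (7 * y) ≡ 7 * x * y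
    swap7 = solve-∀
    swap8 : ∀ x → 8 * (10648 * x) ≡ 10648 * (8 * x)
    swap8 = solve-∀

square-vs-exponential : ∀ K j → 21296 * K ≤ j → 2 * K * ((3 + j) * (3 + j) * 7 ^ j) ≤ 8 ^ j
square-vs-exponential K j large = *-cancelˡ-≤ 10648 (begin
    10648 * (2 * K * (s * s * 7 ^ j))          ≡⟨ regroup K s (7 ^ j) ⟩
    21296 * K * (s * s * 7 ^ j)                ≤⟨ *-monoˡ-≤ (s * s * 7 ^ j) (≤-trans large (m≤n+m j 22)) ⟩
    (22 + j) * (s * s * 7 ^ j)                 ≤⟨ *-monoʳ-≤ (22 + j) (*-monoˡ-≤ (7 ^ j) (*-mono-≤ s≤t s≤t)) ⟩
    (22 + j) * ((22 + j) * (22 + j) * 7 ^ j)   ≡⟨ toCube (22 + j) (7 ^ j) ⟩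
    cube (22 + j) * 7 ^ j                      ≡⟨ cong (λ t → cube t * 7 ^ j) (+-comm 22 j) ⟩
    cube (j + 22) * 7 ^ j                      ≤⟨ cube-vs-exponential j ⟩
    10648 * 8 ^ j                              ∎)
  where
    open ≤-Reasoning
    s : ℕ
    s = 3 + j
    s≤t : 3 + j ≤ 22 + j
    s≤t = +-monoˡ-≤ j (s≤s (s≤s (s≤s z≤n)))
    regroup : ∀ k x y → 10648 * (2 * k * (x * x * y)) ≡ 21296 * k * (x * x * y)
    regroup = solve-∀
    toCube : ∀ x y → x * (x * x * y) ≡ x * x * x * y
    toCube = solve-∀

absorb : ∀ K A D M bad .{{_ : NonZero D}} → bad * D ≤ A * M + D → 2 * K * A ≤ D → 2 * K ≤ M → K * bad ≤ M
absorb K A D M bad hyp smallA smallK = *-cancelʳ-≤ (K * bad) M (2 * D) {{m*n≢0 2 D}} (begin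
    K * bad * (2 * D)            ≡⟨ regroup K bad D ⟩
    2 * K * (bad * D)            ≤⟨ *-monoʳ-≤ (2 * K) hyp ⟩
    2 * K * (A * M + D)          ≡⟨ distribute K A M D ⟩
    2 * K * A * M + 2 * K * D    ≤⟨ +-mono-≤ (*-monoˡ-≤ M smallA) (*-monoˡ-≤ D smallK) ⟩
    D * M + M * D                ≡⟨ collect D M ⟩
    M * (2 * D)                  ∎)
  where
    open ≤-Reasoning
    regroup : ∀ k b d → k * b * (2 * d) ≡ 2 * k * (b * d)
    regroup = solve-∀
    distribute : ∀ k a m d → 2 * k * (a * m + d) ≡ 2 * k * a * m + 2 * k * d
    distribute = solve-∀
    collect : ∀ d m → d * m + m * d ≡ m * (2 * d)
    collect = solve-∀

n≤2^n : ∀ n → n ≤ 2 ^ n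
n≤2^n zero = z≤n
n≤2^n (suc n) = +-mono-≤ (m^n>0 2 n) (≤-trans (n≤2^n n) (m≤m+n (2 ^ n) 0))

shorten : ∀ c p q L j M .{{_ : NonZero q}} → p ≤ q → c * q ^ L ≤ p ^ L * M → j ≤ L → c * q ^ j ≤ p ^ j * M
shorten c p q L j M p≤q bound j≤L = *-cancelʳ-≤ (c * q ^ j) (p ^ j * M) (q ^ d) {{m^n≢0 q d}} (begin
    c * q ^ j * q ^ d       ≡⟨ trans (*-assoc c (q ^ j) (q ^ d)) (cong (c *_) (sym (^-distribˡ-+-* q j d))) ⟩
    c * q ^ (j + d)         ≡⟨ cong (λ t → c * q ^ t) j+d≡L ⟩
    c * q ^ L               ≤⟨ bound ⟩
    p ^ L * M               ≡⟨ cong (λ t → p ^ t * M) j+d≡L ⟨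
    p ^ (j + d) * M         ≡⟨ cong (_* M) (^-distribˡ-+-* p j d) ⟩
    p ^ j * p ^ d * M       ≤⟨ *-monoˡ-≤ M (*-monoʳ-≤ (p ^ j) (^-monoˡ-≤ d p≤q)) ⟩
    p ^ j * q ^ d * M       ≡⟨ regroup (p ^ j) (q ^ d) M ⟩
    p ^ j * M * q ^ d       ∎)
  where
    open ≤-Reasoning
    d : ℕ
    d = L ∸ j
    j+d≡L : j + d ≡ L
    j+d≡L = m+[n∸m]≡n j≤L
    regroup : ∀ x y z → x * y * z ≡ x * z * y
    regroup = solve-∀

module RandomGraphs (n₀ : ℕ) where

  n m : ℕ
  n = suc (suc (suc n₀))
  m = pairs n

  a : Fin n
  a = zero

  commonNeighbour : Vec Bool m → Fin n → Fin n → Fin n → Bool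
  commonNeighbour f u v x = adjOf f x a ∧ (adjOf f x u ∧ adjOf f x v)

  degenerate : Fin n → Fin n → Bool
  degenerate u v = u == a ∨ (v == a ∨ u == v)

  extends : Vec Bool m → Fin n → Fin n → Bool
  extends f u v = degenerate u v ∨ any (commonNeighbour f u v) (allFin n)

  hasExtension : Vec Bool m → Bool
  hasExtension f = all (λ u → all (extends f u) (allFin n)) (allFin n)

  complete : Vec Bool m → Bool
  complete = covers (λ _ → true)

  good : Vec Bool m → Bool
  good f = hasExtension f ∧ not (complete f)

  degenerate-false : ∀ {u v} → u ≢ a → v ≢ a → u ≢ v → degenerate u v ≡ false
  degenerate-false u≢a v≢a u≢v rewrite ==-false u≢a | ==-false v≢a | ==-false u≢v = refl

  third : ∀ (u : Fin n) → ∃[ w ] (w ≢ a × w ≢ u)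
  third zero = suc zero , (λ ()) , (λ ())
  third (suc zero) = suc (suc zero) , (λ ()) , (λ ())
  third (suc (suc u)) = suc zero , (λ ()) , (λ ())

  good⇒cfc≡2 : ∀ f → good f ≡ true → CfcEq (decode f) 2
  good⇒cfc≡2 f isGood = extension⇒cfc≡2 (decode f) a third extend nonEdge
    where
      extension : hasExtension f ≡ true
      extension = proj₁ (∧≡true {hasExtension f} isGood)
      notComplete : not (complete f) ≡ true
      notComplete = proj₂ (∧≡true {hasExtension f} isGood)

      extend : ∀ u v → u ≢ a → v ≢ a → u ≢ v →
        ∃[ x ] (Adjacent (decode f) x a × Adjacent (decode f) x u × Adjacent (decode f) x v)
      extend u v u≢a v≢a u≢v with any-elim (allFin n) witnessed
        where
          witnessed : any (commonNeighbour f u v) (allFin n) ≡ true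
          witnessed = trans (sym (cong (_∨ any (commonNeighbour f u v) (allFin n)) (degenerate-false u≢a v≢a u≢v)))
            (all-elim {p = extends f u} (all-elim {p = λ u → all (extends f u) (allFin n)} extension (∈-allFin u))
                      (∈-allFin v))
      ... | x , _ , common with ∧≡true common
      ... | xa , xuv = x , xa , ∧≡true xuv

      nonEdge : ∃[ i ] ∃[ j ] (i ≢ j × adj (decode f) i j ≡ false)
      nonEdge with uncovered (λ _ → true) f (Boolₚ.not-injective notComplete)
      ... | p , _ , missing with pairIndex-surjective {n} p
      ... | i , j , i≢j , index≡p = i , j , i≢j , trans (adjOf-pair f i≢j) (trans (cong (lookup f) index≡p) missing)

  -- For a non-degenerate pair u, v, the stars {xa, xu, xv} of the n₀ other
  -- vertices x are pairwise disjoint masks of weight 3, and a graph in which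
  -- a, u, v have no common neighbour covers none of them.
  module Star {u v : Fin n} (u≢a : u ≢ a) (v≢a : v ≢ a) (u≢v : u ≢ v) where

    ends : List (Fin n)
    ends = a ∷ u ∷ v ∷ []

    outside : Fin n → Bool
    outside x = not (any (x ==_) ends)

    others : List (Fin n)
    others = filterᵇ outside (allFin n)

    star : Fin n → Mask m
    star x p = any (λ β → edgeMask x β p) ends

    outside⇒≢ : ∀ {x β} → outside x ≡ true → β ∈ ends → x ≢ β
    outside⇒≢ {x} out β∈ends refl =
      contradiction (trans (sym out) (cong not (any-intro {p = x ==_} β∈ends (==-refl x)))) λ ()

    star-weight : ∀ x → weight (star x) ≤ 3
    star-weight x = count-anyOf (edgeMask x) ends (allFin m) (edgeMask-weight x)

    star-disjoint : ∀ {x y} → outside x ≡ true → outside y ≡ true → x ≢ y → Disjoint (star x) (star y)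
    star-disjoint {x} {y} outX outY x≢y p inX with star y p in inY
    ... | false = refl
    ... | true with any-elim ends inX | any-elim ends inY
    ... | β , _ , xβ | γ , γ∈ , yγ with edgeMask-elim x β p xβ | edgeMask-elim y γ p yγ
    ... | x≢β , p≡xβ | y≢γ , p≡yγ with pairIndex-injective x β y γ x≢β y≢γ (trans (sym p≡xβ) p≡yγ)
    ... | inj₁ (x≡y , _) = contradiction x≡y x≢y
    ... | inj₂ (x≡γ , _) = contradiction x≡γ (outside⇒≢ {x} outX γ∈)

    star-covered : ∀ f {x} → outside x ≡ true → covers (star x) f ≡ true → commonNeighbour f u v x ≡ true
    star-covered f {x} out cov =
      cong₂ _∧_ (toEnd (here refl)) (cong₂ _∧_ (toEnd (there (here refl))) (toEnd (there (there (here refl)))))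
      where
        toEnd : ∀ {β} → β ∈ ends → adjOf f x β ≡ true
        toEnd {β} β∈ = trans (adjOf-pair f x≢β) (covers-elim (star x) f cov (pairIndex x β x≢β) inStar)
          where
            x≢β : x ≢ β
            x≢β = outside⇒≢ {x} out β∈
            inStar : star x (pairIndex x β x≢β) ≡ true
            inStar = any-intro {p = λ γ → edgeMask x γ (pairIndex x β x≢β)} β∈ (edgeMask-self x≢β)

    outsiders : All (λ x → outside x ≡ true) others
    outsiders = All.map (Equivalence.to Boolₚ.T-≡) (Allₚ.all-filter (T? ∘ outside) (allFin n))

    avoids-stars : ∀ f → extends f u v ≡ false → avoidsAll (map star others) f ≡ true
    avoids-stars f notExtends = all-intro (Allₚ.map⁺ {f = star} (All.map (λ {x} → notCovered {x}) outsiders))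
      where
        noCommon : any (commonNeighbour f u v) (allFin n) ≡ false
        noCommon = trans (sym (cong (_∨ any (commonNeighbour f u v) (allFin n)) (degenerate-false u≢a v≢a u≢v)))
                         notExtends
        notCovered : ∀ {x} → outside x ≡ true → not (covers (star x) f) ≡ true
        notCovered {x} out with covers (star x) f in cov
        ... | false = refl
        ... | true = contradiction (trans (sym common) noCommon) λ ()
          where
            common : any (commonNeighbour f u v) (allFin n) ≡ true
            common = any-intro {p = commonNeighbour f u v} (∈-allFin x) (star-covered f {x} out cov)

    stars-disjoint : AllPairs Disjoint (map star others)
    stars-disjoint = AllPairsₚ.map⁺ (AllPairs-refine star-disjoint outsiders
      (AllPairsₚ.filter⁺ (T? ∘ outside) (Uniqueₚ.allFin⁺ n)))

    many-others : n₀ ≤ length others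
    many-others = +-cancelʳ-≤ 3 n₀ (length others) (begin
        n₀ + 3                                                        ≡⟨ +-comm n₀ 3 ⟩
        n                                                             ≡⟨ Listₚ.length-tabulate id ⟨
        length (allFin n)                                             ≡⟨ count-complement outside (allFin n) ⟨
        count outside (allFin n) + count (not ∘ outside) (allFin n)   ≤⟨ +-monoʳ-≤ (count outside (allFin n)) atEnds ⟩
        count outside (allFin n) + 3                                  ≡⟨ cong (_+ 3) (length-filterᵇ outside (allFin n)) ⟨
        length others + 3                                             ∎)
      where
        open ≤-Reasoning
        atEnds : count (not ∘ outside) (allFin n) ≤ 3
        atEnds = ≤-trans (≤-reflexive (count-cong (allFin n) (λ x → Boolₚ.not-involutive (any (x ==_) ends))))
          (count-anyOf (λ β x → x == β) ends (allFin n) (λ β → count-==-≤1 β (allFin n) (Uniqueₚ.allFin⁺ n)))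

    bound : count (λ f → not (extends f u v)) (allVecs m) * 8 ^ n₀ ≤ 7 ^ n₀ * 2 ^ m
    bound = shorten (count (λ f → not (extends f u v)) (allVecs m)) 7 8 (length (map star others)) n₀ (2 ^ m) (n≤1+n 7)
      (≤-trans (*-monoˡ-≤ (8 ^ length (map star others)) fewer) avoiding)
      (subst (n₀ ≤_) (sym (Listₚ.length-map star others)) many-others)
      where
        fewer : count (λ f → not (extends f u v)) (allVecs m) ≤ card (avoidsAll (map star others))
        fewer = count-mono (allVecs m) (λ f notExtends → avoids-stars f (Boolₚ.not-injective notExtends))
        avoiding : card (avoidsAll (map star others)) * 8 ^ length (map star others) ≤
                   7 ^ length (map star others) * 2 ^ m
        avoiding = card-avoiding 3 (map star others) stars-disjoint (Allₚ.map⁺ (All.universal star-weight others))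

  pair-bound : ∀ u v → count (λ f → not (extends f u v)) (allVecs m) * 8 ^ n₀ ≤ 7 ^ n₀ * 2 ^ m
  pair-bound u v = byDegeneracy (degenerate u v) refl
    where
      byDegeneracy : ∀ b → degenerate u v ≡ b →
        count (λ f → not (extends f u v)) (allVecs m) * 8 ^ n₀ ≤ 7 ^ n₀ * 2 ^ m
      byDegeneracy true deg = ≤-trans (≤-reflexive (cong (_* 8 ^ n₀) (count-none {xs = allVecs m}
        (All.universal (λ f → cong not (cong (_∨ any (commonNeighbour f u v) (allFin n)) deg)) (allVecs m))))) z≤n
      byDegeneracy false deg with ∨≡false {u == a} deg
      ... | ua , rest with ∨≡false {v == a} rest
      ... | va , uv = Star.bound {u} {v} (==-false⇒≢ ua) (==-false⇒≢ va) (==-false⇒≢ uv)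

  bad : ℕ
  bad = card (not ∘ good)

  -- Union bound over the n² pairs, plus the complete graph.
  bad-bound : bad * 8 ^ n₀ ≤ n * n * 7 ^ n₀ * 2 ^ m + 8 ^ n₀
  bad-bound = begin
      bad * 8 ^ n₀
        ≡⟨ cong (_* 8 ^ n₀) (count-cong (allVecs m) badness) ⟩
      count (λ f → not (hasExtension f) ∨ complete f) (allVecs m) * 8 ^ n₀
        ≤⟨ *-monoˡ-≤ (8 ^ n₀) (count-∨ (not ∘ hasExtension) complete (allVecs m)) ⟩
      (count (not ∘ hasExtension) (allVecs m) + card complete) * 8 ^ n₀
        ≡⟨ *-distribʳ-+ (8 ^ n₀) (count (not ∘ hasExtension) (allVecs m)) (card complete) ⟩
      count (not ∘ hasExtension) (allVecs m) * 8 ^ n₀ + card complete * 8 ^ n₀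
        ≤⟨ +-mono-≤ allPairs (*-monoˡ-≤ (8 ^ n₀) (card-coversAll m)) ⟩
      length (allFin n) * (length (allFin n) * (7 ^ n₀ * 2 ^ m)) + 1 * 8 ^ n₀
        ≡⟨ cong (λ l → l * (l * (7 ^ n₀ * 2 ^ m)) + 1 * 8 ^ n₀) (Listₚ.length-tabulate {n = n} id) ⟩
      n * (n * (7 ^ n₀ * 2 ^ m)) + 1 * 8 ^ n₀
        ≡⟨ regroup n (7 ^ n₀) (2 ^ m) (8 ^ n₀) ⟩
      n * n * 7 ^ n₀ * 2 ^ m + 8 ^ n₀ ∎
    where
      open ≤-Reasoning
      badness : ∀ f → not (good f) ≡ not (hasExtension f) ∨ complete f
      badness f = trans (not-∧ (hasExtension f) _) (cong (not (hasExtension f) ∨_) (Boolₚ.not-involutive (complete f)))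
      allPairs : count (not ∘ hasExtension) (allVecs m) * 8 ^ n₀ ≤
                 length (allFin n) * (length (allFin n) * (7 ^ n₀ * 2 ^ m))
      allPairs = count-notAll (allFin n) (λ u f → all (extends f u) (allFin n)) (allVecs m) (8 ^ n₀) _
        (λ u → count-notAll (allFin n) (λ v f → extends f u v) (allVecs m) (8 ^ n₀) _ (pair-bound u))
      regroup : ∀ n x y z → n * (n * (x * y)) + 1 * z ≡ n * n * x * y + z
      regroup = solve-∀

  goodGraphs : List (Graph n)
  goodGraphs = map (decode {n}) (filterᵇ good (allVecs m))

  goodGraphs-differ : AllPairs Differ goodGraphs
  goodGraphs-differ =
    AllPairsₚ.map⁺ (AllPairs.map (decode-differ _ _) (AllPairsₚ.filter⁺ (T? ∘ good) (allVecs-unique m)))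

  goodGraphs-cfc≡2 : All (λ G → CfcEq G 2) goodGraphs
  goodGraphs-cfc≡2 = Allₚ.map⁺ (All.map (λ {f} isGood → good⇒cfc≡2 f (Equivalence.to Boolₚ.T-≡ isGood))
    (Allₚ.all-filter (T? ∘ good) (allVecs m)))

  missing≡bad : 2 ^ m ∸ length goodGraphs ≡ bad
  missing≡bad = begin
    2 ^ m ∸ length goodGraphs                     ≡⟨ cong₂ _∸_ (sym (length-allVecs m)) countGood ⟩
    length (allVecs m) ∸ card good                ≡⟨ cong (_∸ card good) (count-complement good (allVecs m)) ⟨
    card good + bad ∸ card good                   ≡⟨ m+n∸m≡n (card good) bad ⟩
    bad                                           ∎
    where
      open ≡-Reasoning
      countGood : length goodGraphs ≡ card good
      countGood = trans (Listₚ.length-map (decode {n}) (filterᵇ good (allVecs m))) (length-filterᵇ good (allVecs m))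

  mostlyGood : ∀ K → 21296 * K ≤ n₀ → K * (2 ^ m ∸ length goodGraphs) ≤ 2 ^ m
  mostlyGood K large = subst (λ b → K * b ≤ 2 ^ m) (sym missing≡bad)
    (absorb K (n * n * 7 ^ n₀) (8 ^ n₀) (2 ^ m) bad {{m^n≢0 8 n₀}}
      bad-bound (square-vs-exponential K n₀ large) 2K≤2^m)
    where
      2K≤2^m : 2 * K ≤ 2 ^ m
      2K≤2^m = ≤-trans (*-monoˡ-≤ K (m≤m+n 2 21294)) (≤-trans large (≤-trans n₀≤m (n≤2^n m)))
        where
          n₀≤m : n₀ ≤ m
          n₀≤m = ≤-trans (m≤n+m n₀ 2) (m≤m+n (2 + n₀) _)

theorem1p5 : ∀ (k : ℕ) → ∃[ N ] ∀ (n : ℕ) → N ≤ n →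
    ∃[ gs ] (AllPairs Differ gs × All (λ G → CfcEq {n} G 2) gs
    × suc k * (numGraphs n ∸ length gs) ≤ numGraphs n)
theorem1p5 k = 3 + 21296 * suc k , enoughVertices
  where
    enoughVertices : ∀ n → 3 + 21296 * suc k ≤ n →
      ∃[ gs ] (AllPairs Differ gs × All (λ G → CfcEq {n} G 2) gs × suc k * (numGraphs n ∸ length gs) ≤ numGraphs n)
    enoughVertices (suc (suc (suc n₀))) (s≤s (s≤s (s≤s large))) =
      goodGraphs , goodGraphs-differ , goodGraphs-cfc≡2 ,
      subst (λ e → suc k * (2 ^ e ∸ length goodGraphs) ≤ 2 ^ e) (pairs≡nC2 n) (mostlyGood (suc k) large)
      where open RandomGraphs n₀
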